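{- For every $n\ge1$ there is a bijection between the set $\mathbf{SDR}(n)$ of self-dual regular Boolean functions on $\mathcal{B}_n$ and the set of virtual genetic codes of type $n$.
   Context: $\mathcal{B}_n=\{0,1\}^n$; for $x\in\mathcal{B}_n$, $\bar x_i=1-x_i$. A Boolean function $f:\mathcal{B}_n\to\{0,1\}$ is self-dual if $f(\bar x)=1-f(x)$ for all $x$. Partial order on $\mathcal{B}_n$: $x\preceq y$ iff $x_1+\dots+x_k\le y_1+\dots+y_k$ for all $1\le k\le n$. $f$ is regular if $x\preceq y$ implies $f(x)\le f(y)$. Let $\underline n=\{1,\dots,n\}$; for $A,B\subset\underline n$ write $A\hookrightarrow B$ if there is an order-preserving injective map $\varphi:A\to B$ with $\varphi(x)\ge x$ for all $x\in A$; $\bar A=\underline n\setminus A$. A virtual genetic code of type $n$ is a finite set $\{A_1,\dots,A_k\}$ of subsets of $\underline n$, each containing $n$, such that $A_i\not\hookrightarrow A_j$ for all $i\ne j$ and $\bar A_i\not\hookrightarrow A_j$ for all $i,j$. -}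

module Defs where

open import Level using (0ℓ)
open import Data.Nat as ℕ using (ℕ; zero; suc)
open import Data.Bool as Bo using (Bool; true; false; not)
open import Data.Vec using (Vec; []; _∷_; map)
open import Data.Fin as F using (Fin; fromℕ)
open import Data.Fin.Subset using (Subset; _∈_; ∁)
open import Data.Product using (Σ; _×_; proj₁)
open import Relation.Nullary using (¬_)
open import Relation.Binary.PropositionalEquality using (_≡_; _≢_; refl; sym; trans)
open import Relation.Binary.Bundles using (Setoid)

B : ℕ → Set
B n = Vec Bool n

compl : ∀ {n} → B n → B n
compl = map not

bit : Bool → ℕ
bit false = 0
bit true  = 1

pre : ∀ {n} → ℕ → B n → ℕ
pre zero    _        = 0
pre (suc k) []       = 0
pre (suc k) (b ∷ xs) = bit b ℕ.+ pre k xs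

_⪯_ : ∀ {n} → B n → B n → Set
_⪯_ {n} x y = ∀ k → 1 ℕ.≤ k → k ℕ.≤ n → pre k x ℕ.≤ pre k y

BoolFun : ℕ → Set
BoolFun n = B n → Bool

SelfDual : ∀ {n} → BoolFun n → Set
SelfDual f = ∀ x → f (compl x) ≡ not (f x)

Regular : ∀ {n} → BoolFun n → Set
Regular f = ∀ x y → x ⪯ y → f x Bo.≤ f y

SDR : ℕ → Setoid 0ℓ 0ℓ
SDR n = record
  { Carrier = Σ (BoolFun n) (λ f → SelfDual f × Regular f)
  ; _≈_ = λ f g → ∀ x → proj₁ f x ≡ proj₁ g x
  ; isEquivalence = record
    { refl = λ x → refl ; sym = λ p x → sym (p x) ; trans = λ p q x → trans (p x) (q x) } }

-- Subsets of n̲ = {1,…,n} are Subset n; element i : Fin n stands for i+1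
-- (so the order on Fin n is the order on n̲).
-- A ↪ B : there is an order-preserving injective φ : A → B with φ(x) ≥ x.
-- φ is given as a map on Fin n whose restriction to A is used.
_↪_ : ∀ {n} → Subset n → Subset n → Set
_↪_ {n} A C = Σ (Fin n → Fin n) λ φ →
    (∀ x → x ∈ A → φ x ∈ C)
  × (∀ x y → x ∈ A → y ∈ A → x F.≤ y → φ x F.≤ φ y)
  × (∀ x y → x ∈ A → y ∈ A → φ x ≡ φ y → x ≡ y)
  × (∀ x → x ∈ A → x F.≤ φ x)

SetOfSubsets : ℕ → Set
SetOfSubsets n = Subset n → Bool

_∈ₛ_ : ∀ {n} → Subset n → SetOfSubsets n → Set
A ∈ₛ 𝒞 = 𝒞 A ≡ true

-- virtual genetic code of type n = suc m (the top element n of n̲ is fromℕ m)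
IsVGC : ∀ m → SetOfSubsets (suc m) → Set
IsVGC m 𝒞 =
    (∀ A → A ∈ₛ 𝒞 → fromℕ m ∈ A)
  × (∀ A C → A ∈ₛ 𝒞 → C ∈ₛ 𝒞 → A ≢ C → ¬ (A ↪ C))
  × (∀ A C → A ∈ₛ 𝒞 → C ∈ₛ 𝒞 → ¬ (∁ A ↪ C))

VGC : ℕ → Setoid 0ℓ 0ℓ
VGC m = record
  { Carrier = Σ (SetOfSubsets (suc m)) (IsVGC m)
  ; _≈_ = λ 𝒞 𝒟 → ∀ A → proj₁ 𝒞 A ≡ proj₁ 𝒟 A
  ; isEquivalence = record
    { refl = λ x → refl ; sym = λ p x → sym (p x) ; trans = λ p q x → trans (p x) (q x) } }

module Submission where

-- A subset A of n̲ is read as the point reverse A of B_n.  This turns the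
-- prefix-sum order ⪯ into suffix dominance ≼ on subsets (every final
-- segment {k,…,n} meets A in at most as many elements as C), and a greedy
-- Hall-type argument shows A ≼ C iff A ↪ C.  So the theorem concerns
-- functions h on subsets, monotone for ≼ and self-dual for complement.
-- The codes of h are its ≼-maximal zeros containing n.  They form a virtual
-- genetic code and determine h: a set containing n is a zero iff it lies
-- below a code, and self-duality settles the other sets.  Conversely a
-- virtual genetic code 𝒞 is the set of codes of "A is not below a member of
-- 𝒞" (for n ∈ A), extended self-dually.

open import Defs
open import Data.Nat using (ℕ; zero; suc; _+_; _≤_; _<_; z≤n; s≤s; s≤s⁻¹; _≤?_)
open import Data.Nat.Properties as ℕP using (≤-refl; ≤-trans; <⇒≤; ≰⇒>)
open import Data.Bool as Bool using (Bool; true; false; not; if_then_else_)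
open import Data.Bool.Properties as BoolP using (not-involutive; not-injective)
open import Data.Vec using ([]; _∷_; _∷ʳ_; reverse; here; there)
open import Data.Vec.Properties using (≡-dec; reverse-∷; reverse-involutive; map-reverse)
open import Data.Fin as Fin using (Fin; fromℕ)
open import Data.Fin.Properties as FinP using (suc-injective)
open import Data.Fin.Subset using (Subset; _∈_; _∉_; ∁)
open import Data.Fin.Subset.Properties using (_∈?_; anySubset?; drop-there; x∈p⇒x∉∁p; x∉p⇒x∈∁p)
open import Data.Product using (Σ; ∃; _×_; _,_; proj₁; proj₂)
open import Data.Sum using (_⊎_; inj₁; inj₂)
open import Data.Unit using (⊤; tt)
open import Function using (_∘_; _⇔_; mk⇔)
open import Function.Bundles using (Bijection)
open import Relation.Binary.Bundles using (Setoid)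
open import Relation.Nullary using (¬_; Dec; yes; no; does; contradiction)
open import Relation.Nullary.Decidable using (map′; ¬?; _×-dec_; _→-dec_; decidable-stable; dec-true; dec-false; does-⇔)
open import Relation.Unary using (Decidable)
open import Algebra.Properties.CommutativeSemigroup ℕP.+-commutativeSemigroup using (interchange)
open import Relation.Binary.PropositionalEquality using (_≡_; _≢_; refl; sym; trans; cong; cong₂; subst; subst₂; module ≡-Reasoning)

card : ∀ {n} → Subset n → ℕ
card []      = 0
card (b ∷ A) = bit b + card A

bit-injective : ∀ {a b} → bit a ≡ bit b → a ≡ b
bit-injective {false} {false} _ = refl
bit-injective {true}  {true}  _ = refl

bit-not : ∀ b → bit (not b) + bit b ≡ 1
bit-not false = refl
bit-not true  = refl

card-∁ : ∀ {n} (A : Subset n) → card (∁ A) + card A ≡ n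
card-∁ []      = refl
card-∁ (a ∷ A) = begin
  (bit (not a) + card (∁ A)) + (bit a + card A) ≡⟨ interchange (bit (not a)) (card (∁ A)) (bit a) (card A) ⟩
  (bit (not a) + bit a) + (card (∁ A) + card A) ≡⟨ cong₂ _+_ (bit-not a) (card-∁ A) ⟩
  suc _                                         ∎
  where open ≡-Reasoning

∁-involutive : ∀ {n} (A : Subset n) → ∁ (∁ A) ≡ A
∁-involutive []      = refl
∁-involutive (a ∷ A) = cong₂ _∷_ (not-involutive a) (∁-involutive A)

-- A ≼ C : every final segment of n̲ contains at most as many elements of A
-- as of C.  (Element i : Fin n stands for i+1, so final segments are tails.)
infix 4 _≼_
_≼_ : ∀ {n} → Subset n → Subset n → Set
[]      ≼ []      = ⊤
(a ∷ A) ≼ (c ∷ C) = A ≼ C × card (a ∷ A) ≤ card (c ∷ C)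

≼-refl : ∀ {n} (A : Subset n) → A ≼ A
≼-refl []      = tt
≼-refl (a ∷ A) = ≼-refl A , ≤-refl

≼-trans : ∀ {n} {A B C : Subset n} → A ≼ B → B ≼ C → A ≼ C
≼-trans {A = []}    {[]}    {[]}    _       _       = tt
≼-trans {A = _ ∷ _} {_ ∷ _} {_ ∷ _} (s , l) (t , k) = ≼-trans s t , ≤-trans l k

_≼?_ : ∀ {n} (A C : Subset n) → Dec (A ≼ C)
[]      ≼? []      = yes tt
(a ∷ A) ≼? (c ∷ C) = (A ≼? C) ×-dec (card (a ∷ A) ≤? card (c ∷ C))

-- Complementation reverses ≼, since card (∁ A) = n - card A on every tail.
≼-∁ : ∀ {n} {A C : Subset n} → A ≼ C → ∁ C ≼ ∁ A
≼-∁ {A = []}    {[]}    _       = tt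
≼-∁ {A = a ∷ A} {c ∷ C} (s , l) = ≼-∁ s ,
  ℕP.+-cancelʳ-≤ (card (a ∷ A)) (card (∁ (c ∷ C))) (card (∁ (a ∷ A)))
    (subst (card (∁ (c ∷ C)) + card (a ∷ A) ≤_)
      (trans (card-∁ (c ∷ C)) (sym (card-∁ (a ∷ A))))
      (ℕP.+-monoʳ-≤ (card (∁ (c ∷ C))) l))

-- The sum of all tail counts; it is strictly monotone for ≼, which makes
-- "≼-maximal" computable by maximising a number.
weight : ∀ {n} → Subset n → ℕ
weight []      = 0
weight (a ∷ A) = card (a ∷ A) + weight A

≼-weight : ∀ {n} {A C : Subset n} → A ≼ C → weight A ≤ weight C
≼-weight {A = []}    {[]}    _       = z≤n
≼-weight {A = _ ∷ _} {_ ∷ _} (s , l) = ℕP.+-mono-≤ l (≼-weight s)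

+-≡-split : ∀ {x y u v} → x ≤ y → u ≤ v → x + u ≡ y + v → x ≡ y × u ≡ v
+-≡-split {x} {y} {u} {v} x≤y u≤v e = x≡y , ℕP.+-cancelˡ-≡ x u v (trans e (cong (_+ v) (sym x≡y)))
  where
  x≡y : x ≡ y
  x≡y = ℕP.≤-antisym x≤y (ℕP.+-cancelʳ-≤ v y x (subst (_≤ x + v) e (ℕP.+-monoʳ-≤ x u≤v)))

≼-weight-≡ : ∀ {n} {A C : Subset n} → A ≼ C → weight A ≡ weight C → A ≡ C
≼-weight-≡ {A = []}    {[]}    _       _ = refl
≼-weight-≡ {A = a ∷ A} {c ∷ C} (s , l) e with +-≡-split l (≼-weight s) e
... | cards , weights with refl ← ≼-weight-≡ s weights =
  cong (_∷ A) (bit-injective (ℕP.+-cancelʳ-≡ (card A) (bit a) (bit c) cards))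

≼-antisym : ∀ {n} {A C : Subset n} → A ≼ C → C ≼ A → A ≡ C
≼-antisym s t = ≼-weight-≡ s (ℕP.≤-antisym (≼-weight s) (≼-weight t))

-- The last final segment is {n}: sets above a set containing n contain n.
≼-top : ∀ m {A C : Subset (suc m)} → A ≼ C → fromℕ m ∈ A → fromℕ m ∈ C
≼-top zero    {true ∷ []} {true ∷ []} _       here      = here
≼-top zero    {true ∷ []} {false ∷ []} (_ , ()) here
≼-top (suc m) {_ ∷ _}     {_ ∷ _}     (s , _) (there p) = there (≼-top m s p)

-- Suffix dominance is prefix dominance of the reversed points.

-- Prefix dominance with all cut points k (those beyond n repeat the total).
infix 4 _⊑_
_⊑_ : ∀ {n} → B n → B n → Set
x ⊑ y = ∀ k → pre k x ≤ pre k y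

pre-card : ∀ {n} k (x : B n) → n ≤ k → pre k x ≡ card x
pre-card zero    []      _       = refl
pre-card (suc k) []      _       = refl
pre-card (suc k) (b ∷ x) (s≤s l) = cong (bit b +_) (pre-card k x l)

pre-∷ʳ : ∀ {n} k (x : B n) a → k ≤ n → pre k (x ∷ʳ a) ≡ pre k x
pre-∷ʳ zero    _       _ _       = refl
pre-∷ʳ (suc k) (b ∷ x) a (s≤s l) = cong (bit b +_) (pre-∷ʳ k x a l)

card-∷ʳ : ∀ {n} (x : B n) a → card (x ∷ʳ a) ≡ bit a + card x
card-∷ʳ []      a = refl
card-∷ʳ (b ∷ x) a = begin
  bit b + card (x ∷ʳ a)  ≡⟨ cong (bit b +_) (card-∷ʳ x a) ⟩
  bit b + (bit a + card x) ≡⟨ ℕP.+-comm (bit b) _ ⟩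
  (bit a + card x) + bit b ≡⟨ ℕP.+-assoc (bit a) (card x) (bit b) ⟩
  bit a + (card x + bit b) ≡⟨ cong (bit a +_) (ℕP.+-comm (card x) (bit b)) ⟩
  bit a + (bit b + card x) ∎
  where open ≡-Reasoning

card-reverse : ∀ {n} (A : Subset n) → card (reverse A) ≡ card A
card-reverse []      = refl
card-reverse (a ∷ A) = begin
  card (reverse (a ∷ A))  ≡⟨ cong card (reverse-∷ a A) ⟩
  card (reverse A ∷ʳ a)   ≡⟨ card-∷ʳ (reverse A) a ⟩
  bit a + card (reverse A) ≡⟨ cong (bit a +_) (card-reverse A) ⟩
  bit a + card A           ∎
  where open ≡-Reasoning

-- Cut points beyond n add nothing.
⊑-from-bounded : ∀ {n} {x y : B n} → (∀ k → k ≤ n → pre k x ≤ pre k y) → x ⊑ y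
⊑-from-bounded {n} {x} {y} p k with k ≤? n
... | yes k≤n = p k k≤n
... | no  k≰n = subst₂ _≤_ (total x) (total y) (p n ≤-refl)
  where
  total : ∀ z → pre n z ≡ pre k z
  total z = trans (pre-card n z ≤-refl) (sym (pre-card k z (<⇒≤ (≰⇒> k≰n))))

⪯⇒⊑ : ∀ {n} {x y : B n} → x ⪯ y → x ⊑ y
⪯⇒⊑ p = ⊑-from-bounded λ { zero _ → z≤n ; (suc k) l → p (suc k) (s≤s z≤n) l }

⊑-∷ʳ⁻ : ∀ {n} {x y : B n} {a c} → (x ∷ʳ a) ⊑ (y ∷ʳ c) → x ⊑ y × card (x ∷ʳ a) ≤ card (y ∷ʳ c)
⊑-∷ʳ⁻ {n} {x} {y} {a} {c} p =
  ⊑-from-bounded (λ k l → subst₂ _≤_ (pre-∷ʳ k x a l) (pre-∷ʳ k y c l) (p k)) ,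
  subst₂ _≤_ (pre-card (suc n) (x ∷ʳ a) ≤-refl) (pre-card (suc n) (y ∷ʳ c) ≤-refl) (p (suc n))

⊑-∷ʳ⁺ : ∀ {n} {x y : B n} {a c} → x ⊑ y → card (x ∷ʳ a) ≤ card (y ∷ʳ c) → (x ∷ʳ a) ⊑ (y ∷ʳ c)
⊑-∷ʳ⁺ {n} {x} {y} {a} {c} p l k with k ≤? n
... | yes k≤n = subst₂ _≤_ (sym (pre-∷ʳ k x a k≤n)) (sym (pre-∷ʳ k y c k≤n)) (p k)
... | no  k≰n = subst₂ _≤_ (sym (pre-card k (x ∷ʳ a) n<k)) (sym (pre-card k (y ∷ʳ c) n<k)) l
  where n<k = ≰⇒> k≰n

card-reverse-∷ : ∀ {n} a (A : Subset n) → card (reverse A ∷ʳ a) ≡ card (a ∷ A)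
card-reverse-∷ a A = trans (card-∷ʳ (reverse A) a) (cong (bit a +_) (card-reverse A))

≼⇒⊑ : ∀ {n} {A C : Subset n} → A ≼ C → reverse A ⊑ reverse C
≼⇒⊑ {A = []}    {[]}    _ = λ { zero → z≤n ; (suc k) → z≤n }
≼⇒⊑ {A = a ∷ A} {c ∷ C} (s , l) rewrite reverse-∷ a A | reverse-∷ c C =
  ⊑-∷ʳ⁺ (≼⇒⊑ s) (subst₂ _≤_ (sym (card-reverse-∷ a A)) (sym (card-reverse-∷ c C)) l)

⊑⇒≼ : ∀ {n} {A C : Subset n} → reverse A ⊑ reverse C → A ≼ C
⊑⇒≼ {A = []}    {[]}    _ = tt
⊑⇒≼ {A = a ∷ A} {c ∷ C} p rewrite reverse-∷ a A | reverse-∷ c C with ⊑-∷ʳ⁻ p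
... | q , l = ⊑⇒≼ q , subst₂ _≤_ (card-reverse-∷ a A) (card-reverse-∷ c C) l

≼⇒⪯ : ∀ {n} {A C : Subset n} → A ≼ C → reverse A ⪯ reverse C
≼⇒⪯ s k _ _ = ≼⇒⊑ s k

⪯⇒≼ : ∀ {n} {x y : B n} → x ⪯ y → reverse x ≼ reverse y
⪯⇒≼ {x = x} {y} p = ⊑⇒≼ (subst₂ _⊑_ (sym (reverse-involutive x)) (sym (reverse-involutive y)) (⪯⇒⊑ p))

-- Suffix dominance is embeddability.

remove : ∀ {n} → Fin n → Subset n → Subset n
remove Fin.zero    (_ ∷ C) = false ∷ C
remove (Fin.suc j) (c ∷ C) = c ∷ remove j C

remove-⊆ : ∀ {n} {C : Subset n} {j k} → k ∈ remove j C → k ∈ C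
remove-⊆ {C = _ ∷ _} {Fin.zero}  (there q) = there q
remove-⊆ {C = _ ∷ _} {Fin.suc j} here      = here
remove-⊆ {C = _ ∷ _} {Fin.suc j} (there q) = there (remove-⊆ q)

remove-≢ : ∀ {n} {C : Subset n} {j k} → k ∈ remove j C → k ≢ j
remove-≢ {C = _ ∷ _} {Fin.zero}  (there q) ()
remove-≢ {C = _ ∷ _} {Fin.suc j} here      ()
remove-≢ {C = _ ∷ _} {Fin.suc j} (there q) e = remove-≢ q (suc-injective e)

∈-remove : ∀ {n} {C : Subset n} {k j} → k ∈ C → k ≢ j → k ∈ remove j C
∈-remove {k = Fin.zero}  {Fin.zero}  here      k≢j = contradiction refl k≢j
∈-remove {k = Fin.zero}  {Fin.suc j} here      _   = here
∈-remove {k = Fin.suc k} {Fin.zero}  (there p) _   = there p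
∈-remove {k = Fin.suc k} {Fin.suc j} (there p) k≢j = there (∈-remove p (k≢j ∘ cong Fin.suc))

card-remove : ∀ {n} {C : Subset n} {j} → j ∈ C → suc (card (remove j C)) ≡ card C
card-remove {j = Fin.zero}  here = refl
card-remove {C = c ∷ C} {Fin.suc j} (there p) =
  trans (sym (ℕP.+-suc (bit c) (card (remove j C)))) (cong (bit c +_) (card-remove p))

least : ∀ {n} (C : Subset n) → .(0 < card C) → Fin n
least (true ∷ C)  _ = Fin.zero
least (false ∷ C) p = Fin.suc (least C p)

least-∈ : ∀ {n} (C : Subset n) .p → least C p ∈ C
least-∈ (true ∷ C)  _ = here
least-∈ (false ∷ C) p = there (least-∈ C p)

least-≤ : ∀ {n} (C : Subset n) .p {k} → k ∈ C → least C p Fin.≤ k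
least-≤ (true ∷ C)  _ _         = z≤n
least-≤ (false ∷ C) p (there q) = s≤s (least-≤ C p q)

≼-remove-least : ∀ {n} {A C : Subset n} (s : A ≼ C) (l : card A < card C) → A ≼ remove (least C (ℕP.<-≤-trans (s≤s z≤n) l)) C
≼-remove-least {A = []}    {[]}        _       ()
≼-remove-least {A = a ∷ A} {true ∷ C}  (s , _) l = s , s≤s⁻¹ l
≼-remove-least {A = a ∷ A} {false ∷ C} (s , _) l =
  ≼-remove-least s (ℕP.<-≤-trans (s≤s (ℕP.m≤n+m (card A) (bit a))) l) ,
  s≤s⁻¹ (subst (suc (card (a ∷ A)) ≤_) (sym (card-remove (least-∈ C _))) l)

↪-skip : ∀ {n} {A C : Subset n} {c} → A ↪ C → (false ∷ A) ↪ (c ∷ C)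
↪-skip (φ , into , mono , inj , up) = ψ , into′ , mono′ , inj′ , up′
  where
  ψ : Fin (suc _) → Fin (suc _)
  ψ Fin.zero    = Fin.zero
  ψ (Fin.suc i) = Fin.suc (φ i)
  into′ = λ { (Fin.suc x) (there p) → there (into x p) }
  mono′ = λ { (Fin.suc x) (Fin.suc y) (there p) (there q) l → s≤s (mono x y p q (s≤s⁻¹ l)) }
  inj′  = λ { (Fin.suc x) (Fin.suc y) (there p) (there q) e → cong Fin.suc (inj x y p q (suc-injective e)) }
  up′   = λ { (Fin.suc x) (there p) → s≤s (up x p) }

↪-claim : ∀ {n} {A C D : Subset n} {c} → A ↪ D → (∀ {k} → k ∈ D → k ∈ C) →
          (j : Fin (suc n)) → j ∈ (c ∷ C) → (∀ {k} → k ∈ D → j Fin.< Fin.suc k) →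
          (true ∷ A) ↪ (c ∷ C)
↪-claim (φ , into , mono , inj , up) D⊆C j j∈ j< = ψ , into′ , mono′ , inj′ , up′
  where
  ψ : Fin (suc _) → Fin (suc _)
  ψ Fin.zero    = j
  ψ (Fin.suc i) = Fin.suc (φ i)
  into′ = λ { Fin.zero here → j∈ ; (Fin.suc x) (there p) → there (D⊆C (into x p)) }
  mono′ = λ { Fin.zero Fin.zero _ _ _ → ≤-refl
            ; Fin.zero (Fin.suc y) _ (there q) _ → <⇒≤ (j< (into y q))
            ; (Fin.suc x) (Fin.suc y) (there p) (there q) l → s≤s (mono x y p q (s≤s⁻¹ l)) }
  inj′  = λ { Fin.zero Fin.zero _ _ _ → refl
            ; Fin.zero (Fin.suc y) _ (there q) e → contradiction e (FinP.<⇒≢ (j< (into y q)))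
            ; (Fin.suc x) Fin.zero (there p) _ e → contradiction (sym e) (FinP.<⇒≢ (j< (into x p)))
            ; (Fin.suc x) (Fin.suc y) (there p) (there q) e → cong Fin.suc (inj x y p q (suc-injective e)) }
  up′   = λ { Fin.zero _ → z≤n ; (Fin.suc x) (there p) → s≤s (up x p) }

-- Greedy construction: each element of A, from the left, takes the least
-- available element of C not to its left.
≼⇒↪ : ∀ {n} {A C : Subset n} → A ≼ C → A ↪ C
≼⇒↪ {A = []}       {[]}        _ = (λ ()) , (λ ()) , (λ ()) , (λ ()) , (λ ())
≼⇒↪ {A = false ∷ A} {_ ∷ _}    (s , _) = ↪-skip (≼⇒↪ s)
≼⇒↪ {A = true ∷ A}  {true ∷ C} (s , _) = ↪-claim (≼⇒↪ s) (λ k∈ → k∈) Fin.zero here (λ _ → s≤s z≤n)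
≼⇒↪ {A = true ∷ A}  {false ∷ C} (s , l) =
  ↪-claim (≼⇒↪ (≼-remove-least s l)) remove-⊆ (Fin.suc (least C _)) (there (least-∈ C _))
    (λ k∈ → s≤s (FinP.≤∧≢⇒< (least-≤ C _ (remove-⊆ k∈)) (remove-≢ k∈ ∘ sym)))

pred-or : ∀ {n} → Fin (suc n) → Fin n → Fin n
pred-or Fin.zero    d = d
pred-or (Fin.suc k) _ = k

pred-or-suc : ∀ {n} (x : Fin (suc n)) (i : Fin n) → Fin.suc i Fin.≤ x → x ≡ Fin.suc (pred-or x i)
pred-or-suc (Fin.suc k) _ _ = refl

-- Restricting an embedding of a ∷ A to the tail A; the images of tail
-- elements, which are never 0, land in any D that contains them.
↪-tail : ∀ {n a c} {A C : Subset n} (e : (a ∷ A) ↪ (c ∷ C)) (D : Subset n) →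
         (∀ {i k} → i ∈ A → proj₁ e (Fin.suc i) ≡ Fin.suc k → k ∈ D) → A ↪ D
↪-tail {A = A} (φ , into , mono , inj , up) D into-D = ψ , into′ , mono′ , inj′ , up′
  where
  ψ : Fin _ → Fin _
  ψ i = pred-or (φ (Fin.suc i)) i
  φ-suc : ∀ {i} → i ∈ A → φ (Fin.suc i) ≡ Fin.suc (ψ i)
  φ-suc {i} p = pred-or-suc (φ (Fin.suc i)) i (up (Fin.suc i) (there p))
  into′ = λ i p → into-D p (φ-suc p)
  mono′ = λ x y p q l → s≤s⁻¹ (subst₂ Fin._≤_ (φ-suc p) (φ-suc q) (mono _ _ (there p) (there q) (s≤s l)))
  inj′  = λ x y p q e → suc-injective (inj _ _ (there p) (there q) (trans (φ-suc p) (trans (cong Fin.suc e) (sym (φ-suc q)))))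
  up′   = λ x p → s≤s⁻¹ (subst (Fin.suc x Fin.≤_) (φ-suc p) (up (Fin.suc x) (there p)))

↪-tail-into : ∀ {n a c} {A C : Subset n} (e : (a ∷ A) ↪ (c ∷ C)) → A ↪ C
↪-tail-into {c = c} {C = C} e@(_ , into , _) =
  ↪-tail e C (λ p φi≡ → drop-there (subst (_∈ (c ∷ C)) φi≡ (into _ (there p))))

↪-card : ∀ {n} {A C : Subset n} → A ↪ C → card A ≤ card C
↪-card {A = []}        {[]}         _ = z≤n
↪-card {A = false ∷ A} {c ∷ C}      e = ≤-trans (↪-card (↪-tail-into e)) (ℕP.m≤n+m (card C) (bit c))
↪-card {A = true ∷ A}  {true ∷ C}   e = s≤s (↪-card (↪-tail-into e))
↪-card {A = true ∷ A}  {false ∷ C}  e@(φ , into , _ , inj , _) with φ Fin.zero in φ0 | into Fin.zero here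
... | Fin.suc j | there j∈ = subst (suc (card A) ≤_) (card-remove j∈) (s≤s (↪-card (↪-tail e (remove j C) into-rest)))
  where
  -- images of tail elements avoid j = φ 0 by injectivity
  into-rest : ∀ {i k} → i ∈ A → φ (Fin.suc i) ≡ Fin.suc k → k ∈ remove j C
  into-rest {i} p φi≡ = ∈-remove (drop-there (subst (_∈ (false ∷ C)) φi≡ (into (Fin.suc i) (there p))))
    (λ k≡j → suc≢zero (inj _ _ (there p) here (trans φi≡ (trans (cong Fin.suc k≡j) (sym φ0)))))
    where
    suc≢zero : Fin.suc i ≢ Fin.zero
    suc≢zero ()

↪⇒≼ : ∀ {n} {A C : Subset n} → A ↪ C → A ≼ C
↪⇒≼ {A = []}    {[]}    _ = tt
↪⇒≼ {A = _ ∷ _} {_ ∷ _} e = ↪⇒≼ (↪-tail-into e) , ↪-card e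

allSubsets? : ∀ {n} {P : Subset n → Set} → Decidable P → Dec (∀ v → P v)
allSubsets? P? = map′ (λ ¬∃¬ v → decidable-stable (P? v) (λ ¬p → ¬∃¬ (v , ¬p)))
                      (λ ∀P (v , ¬p) → ¬p (∀P v))
                      (¬? (anySubset? (¬? ∘ P?)))

MaximumOf : ∀ {n} → (Subset n → Set) → (Subset n → ℕ) → Subset n → Set
MaximumOf P w z = P z × (∀ v → P v → w v ≤ w z)

maximum : ∀ {n} {P : Subset n → Set} → Decidable P → (w : Subset n → ℕ) →
          ∃ (MaximumOf P w) ⊎ (∀ v → ¬ P v)
maximum {zero} P? w with P? []
... | yes p = inj₁ ([] , p , λ { [] _ → ≤-refl })
... | no ¬p = inj₂ λ { [] → ¬p }
maximum {suc n} P? w with maximum (P? ∘ (true ∷_)) (w ∘ (true ∷_)) | maximum (P? ∘ (false ∷_)) (w ∘ (false ∷_))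
... | inj₂ ¬t | inj₂ ¬f = inj₂ λ { (true ∷ v) → ¬t v ; (false ∷ v) → ¬f v }
... | inj₁ (z , pz , mz) | inj₂ ¬f =
  inj₁ (true ∷ z , pz , λ { (true ∷ v) p → mz v p ; (false ∷ v) p → contradiction p (¬f v) })
... | inj₂ ¬t | inj₁ (z , pz , mz) =
  inj₁ (false ∷ z , pz , λ { (true ∷ v) p → contradiction p (¬t v) ; (false ∷ v) p → mz v p })
... | inj₁ (zt , pt , mt) | inj₁ (zf , pf , mf) with w (true ∷ zt) ≤? w (false ∷ zf)
...   | yes le = inj₁ (false ∷ zf , pf , λ { (true ∷ v) p → ≤-trans (mt v p) le ; (false ∷ v) p → mf v p })
...   | no ¬le = inj₁ (true ∷ zt , pt , λ { (true ∷ v) p → mt v p ; (false ∷ v) p → ≤-trans (mf v p) (<⇒≤ (≰⇒> ¬le)) })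

≤-false : ∀ {a b : Bool} → a Bool.≤ b → b ≡ false → a ≡ false
≤-false Bool.b≤b e = e

≤-from-false : ∀ {a b : Bool} → (b ≡ false → a ≡ false) → a Bool.≤ b
≤-from-false {false} {_}     _ = BoolP.≤-minimum _
≤-from-false {true}  {true}  _ = Bool.b≤b
≤-from-false {true}  {false} h with () ← h refl

≡-from-false : ∀ {a b : Bool} → (a ≡ false → b ≡ false) → (b ≡ false → a ≡ false) → a ≡ b
≡-from-false f g = BoolP.≤-antisym (≤-from-false g) (≤-from-false f)

does-true : ∀ {P : Set} (d : Dec P) → does d ≡ true → P
does-true (yes p) _ = p

does-≡ : ∀ {P : Set} (d : Dec P) {b} → P ⇔ (b ≡ true) → does d ≡ b
does-≡ d {b} P⇔b = trans (does-⇔ P⇔b d (b Bool.≟ true)) (lemma b)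
  where
  lemma : ∀ b → does (b Bool.≟ true) ≡ b
  lemma false = refl
  lemma true  = refl

module Codes (m : ℕ) where

  top : Fin (suc m)
  top = fromℕ m

  Fun : Set
  Fun = Subset (suc m) → Bool

  Monotone : Fun → Set
  Monotone h = ∀ {A C} → A ≼ C → h A Bool.≤ h C

  SelfDualₛ : Fun → Set
  SelfDualₛ h = ∀ A → h (∁ A) ≡ not (h A)

  onSubsets : BoolFun (suc m) → Fun
  onSubsets f = f ∘ reverse

  regular⇒monotone : ∀ {f} → Regular f → Monotone (onSubsets f)
  regular⇒monotone reg {A} {C} s = reg (reverse A) (reverse C) (≼⇒⪯ s)

  selfDual⇒selfDualₛ : ∀ {f} → SelfDual f → SelfDualₛ (onSubsets f)
  selfDual⇒selfDualₛ {f} sd A = trans (cong f (sym (map-reverse not A))) (sd (reverse A))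

  monotone⇒regular : ∀ {h} → Monotone h → Regular (onSubsets h)
  monotone⇒regular mono x y p = mono (⪯⇒≼ p)

  selfDualₛ⇒selfDual : ∀ {h} → SelfDualₛ h → SelfDual (onSubsets h)
  selfDualₛ⇒selfDual {h} sd x = trans (cong h (sym (map-reverse not x))) (sd (reverse x))

  top-cases : ∀ {X : Set} A → (top ∈ A → X) → (top ∉ A → X) → X
  top-cases A with-top without-top with top ∈? A
  ... | yes t  = with-top t
  ... | no  ¬t = without-top ¬t

  IsCode : Fun → Subset (suc m) → Set
  IsCode h A = top ∈ A × h A ≡ false × (∀ C → A ≼ C → h C ≡ false → C ≼ A)

  isCode? : ∀ h A → Dec (IsCode h A)
  isCode? h A = (top ∈? A) ×-dec (h A Bool.≟ false) ×-dec
    allSubsets? (λ C → (A ≼? C) →-dec (h C Bool.≟ false) →-dec (C ≼? A))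

  codes : Fun → SetOfSubsets (suc m)
  codes h A = does (isCode? h A)

  IsCode-cong : ∀ {h h′} → (∀ A → h A ≡ h′ A) → ∀ {A} → IsCode h A → IsCode h′ A
  IsCode-cong h≗h′ (t , hA , maximal) =
    t , trans (sym (h≗h′ _)) hA , λ C s h′C → maximal C s (trans (h≗h′ C) h′C)

  codes-cong : ∀ {h h′} → (∀ A → h A ≡ h′ A) → ∀ A → codes h A ≡ codes h′ A
  codes-cong h≗h′ A = does-⇔ (mk⇔ (IsCode-cong h≗h′) (IsCode-cong (sym ∘ h≗h′))) (isCode? _ A) (isCode? _ A)

  zero⇒below-code : ∀ {h} → Monotone h → ∀ {A} → top ∈ A → h A ≡ false →
                    Σ _ λ C → IsCode h C × A ≼ C
  zero⇒below-code {h} mono {A} t hA with maximum (λ v → (A ≼? v) ×-dec (h v Bool.≟ false)) weight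
  ... | inj₂ none = contradiction (≼-refl A , hA) (none A)
  ... | inj₁ (z , (A≼z , hz) , z-max) = z , (≼-top m A≼z t , hz , z-maximal) , A≼z
    where
    z-maximal : ∀ C → z ≼ C → h C ≡ false → C ≼ z
    z-maximal C z≼C hC with refl ← ≼-weight-≡ z≼C (ℕP.≤-antisym (≼-weight z≼C) (z-max C (≼-trans A≼z z≼C , hC))) = ≼-refl z

  below-code⇒zero : ∀ {h} → Monotone h → ∀ {A C} → IsCode h C → A ≼ C → h A ≡ false
  below-code⇒zero mono (_ , hC , _) A≼C = ≤-false (mono A≼C) hC

  complement-of-zero : ∀ {h} → SelfDualₛ h → ∀ A → h A ≡ false → h (∁ A) ≢ false
  complement-of-zero {h} sd A hA h∁A = contradiction equation λ ()
    where
    open ≡-Reasoning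
    equation : true ≡ false
    equation = begin
      true       ≡⟨ cong not hA ⟨
      not (h A)  ≡⟨ sd A ⟨
      h (∁ A)    ≡⟨ h∁A ⟩
      false      ∎

  codes-isVGC : ∀ {h} → Monotone h → SelfDualₛ h → IsVGC m (codes h)
  codes-isVGC {h} mono sd = (λ A A∈ → proj₁ (code A∈)) , incomparable , no-complement
    where
    code : ∀ {A} → A ∈ₛ codes h → IsCode h A
    code {A} = does-true (isCode? h A)
    incomparable : ∀ A C → A ∈ₛ codes h → C ∈ₛ codes h → A ≢ C → ¬ (A ↪ C)
    incomparable A C A∈ C∈ A≢C A↪C = A≢C (≼-antisym A≼C (proj₂ (proj₂ (code A∈)) C A≼C (proj₁ (proj₂ (code C∈)))))
      where A≼C = ↪⇒≼ A↪C
    -- h (∁ A) would be false by monotonicity, but it is not (h A) = true.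
    no-complement : ∀ A C → A ∈ₛ codes h → C ∈ₛ codes h → ¬ (∁ A ↪ C)
    no-complement A C A∈ C∈ ∁A↪C =
      complement-of-zero sd A (proj₁ (proj₂ (code A∈))) (below-code⇒zero mono (code C∈) (↪⇒≼ ∁A↪C))

  codes-injective : ∀ {h h′} → Monotone h → SelfDualₛ h → Monotone h′ → SelfDualₛ h′ →
                    (∀ A → codes h A ≡ codes h′ A) → ∀ A → h A ≡ h′ A
  codes-injective {h} {h′} mono sd mono′ sd′ same = agree
    where
    transport : ∀ {g g′} → (∀ A → codes g A ≡ codes g′ A) → ∀ {C} → IsCode g C → IsCode g′ C
    transport {g} {g′} eq {C} c = does-true (isCode? g′ C) (trans (sym (eq C)) (dec-true (isCode? g C) c))
    zeros : ∀ {g g′} → Monotone g → Monotone g′ → (∀ A → codes g A ≡ codes g′ A) →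
            ∀ {A} → top ∈ A → g A ≡ false → g′ A ≡ false
    zeros mono-g mono-g′ eq t gA with zero⇒below-code mono-g t gA
    ... | C , c , A≼C = below-code⇒zero mono-g′ (transport eq c) A≼C
    agree-top : ∀ {A} → top ∈ A → h A ≡ h′ A
    agree-top t = ≡-from-false (zeros mono mono′ same t) (zeros mono′ mono (sym ∘ same) t)
    agree : ∀ A → h A ≡ h′ A
    agree A = top-cases A agree-top λ ¬t →
      not-injective (trans (sym (sd A)) (trans (agree-top (x∉p⇒x∈∁p ¬t)) (sd′ A)))

  module FromVGC (𝒞 : SetOfSubsets (suc m)) (vgc : IsVGC m 𝒞) where
    private
      contains-top  = proj₁ vgc
      antichain     = proj₁ (proj₂ vgc)
      no-complement = proj₂ (proj₂ vgc)

    Covered : Subset (suc m) → Set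
    Covered A = Σ _ λ C → C ∈ₛ 𝒞 × A ≼ C

    covered? : ∀ A → Dec (Covered A)
    covered? A = anySubset? (λ C → (𝒞 C Bool.≟ true) ×-dec (A ≼? C))

    covered : Subset (suc m) → Bool
    covered A = does (covered? A)

    h : Fun
    h A = if does (top ∈? A) then not (covered A) else covered (∁ A)

    h-top : ∀ {A} → top ∈ A → h A ≡ not (covered A)
    h-top {A} t with top ∈? A
    ... | yes _ = refl
    ... | no ¬t = contradiction t ¬t

    h-bottom : ∀ {A} → top ∉ A → h A ≡ covered (∁ A)
    h-bottom {A} ¬t with top ∈? A
    ... | yes t = contradiction t ¬t
    ... | no _  = refl

    zero⇒covered : ∀ {A} → top ∈ A → h A ≡ false → Covered A
    zero⇒covered {A} t hA = does-true (covered? A) (not-injective (trans (sym (h-top t)) hA))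

    h-selfDual : SelfDualₛ h
    h-selfDual A = top-cases A with-top without-top
      where
      open ≡-Reasoning
      with-top : top ∈ A → h (∁ A) ≡ not (h A)
      with-top t = begin
        h (∁ A)                ≡⟨ h-bottom (x∈p⇒x∉∁p t) ⟩
        covered (∁ (∁ A))      ≡⟨ cong covered (∁-involutive A) ⟩
        covered A              ≡⟨ not-involutive _ ⟨
        not (not (covered A))  ≡⟨ cong not (h-top t) ⟨
        not (h A)              ∎
      without-top : top ∉ A → h (∁ A) ≡ not (h A)
      without-top ¬t = trans (h-top (x∉p⇒x∈∁p ¬t)) (cong not (sym (h-bottom ¬t)))

    -- For A containing n, zeros propagate downwards because covering does.
    zero-below-top : ∀ {A C} → top ∈ A → A ≼ C → h C ≡ false → h A ≡ false
    zero-below-top {A} {C} tA A≼C hC with zero⇒covered (≼-top m A≼C tA) hC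
    ... | c , c∈ , C≼c = trans (h-top tA) (cong not (dec-true (covered? A) (c , c∈ , ≼-trans A≼C C≼c)))

    -- ∁ c ≼ A ≼ C ≼ c′ with c, c′ ∈ 𝒞 is excluded by the code conditions.
    uncovered-below-covered : ∀ {A C} → A ≼ C → Covered C → ¬ Covered (∁ A)
    uncovered-below-covered {A} A≼C (c′ , c′∈ , C≼c′) (c , c∈ , ∁A≼c) =
      no-complement c c′ c∈ c′∈ (≼⇒↪ (≼-trans (subst (∁ c ≼_) (∁-involutive A) (≼-∁ ∁A≼c)) (≼-trans A≼C C≼c′)))

    -- For A without n, a cover of ∁ A would contradict the code conditions
    -- (if n ∈ C) or the vanishing of h C (if n ∉ C).
    zero-below-bottom : ∀ {A C} → top ∉ A → A ≼ C → h C ≡ false → h A ≡ false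
    zero-below-bottom {A} {C} ¬tA A≼C hC = trans (h-bottom ¬tA) (dec-false (covered? (∁ A)) (top-cases C C-top C-bottom))
      where
      C-top : top ∈ C → ¬ Covered (∁ A)
      C-top tC = uncovered-below-covered A≼C (zero⇒covered tC hC)
      C-bottom : top ∉ C → ¬ Covered (∁ A)
      C-bottom ¬tC (c , c∈ , ∁A≼c) = contradiction
        (trans (sym (dec-true (covered? (∁ C)) (c , c∈ , ≼-trans (≼-∁ A≼C) ∁A≼c))) (trans (sym (h-bottom ¬tC)) hC))
        λ ()

    h-monotone : Monotone h
    h-monotone {A} {C} A≼C = ≤-from-false λ hC →
      top-cases A (λ tA → zero-below-top tA A≼C hC) (λ ¬tA → zero-below-bottom ¬tA A≼C hC)

    member⇒code : ∀ {A} → A ∈ₛ 𝒞 → IsCode h A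
    member⇒code {A} A∈ = tA , trans (h-top tA) (cong not (dec-true (covered? A) (A , A∈ , ≼-refl A))) , maximal
      where
      tA = contains-top A A∈
      maximal : ∀ C → A ≼ C → h C ≡ false → C ≼ A
      maximal C A≼C hC with zero⇒covered (≼-top m A≼C tA) hC
      ... | c , c∈ , C≼c with ≡-dec Bool._≟_ A c
      ...   | yes refl = C≼c
      ...   | no  A≢c  = contradiction (≼⇒↪ (≼-trans A≼C C≼c)) (antichain A c A∈ c∈ A≢c)

    code⇒member : ∀ {A} → IsCode h A → A ∈ₛ 𝒞
    code⇒member (tA , hA , maximal) with zero⇒covered tA hA
    ... | c , c∈ , A≼c with refl ← ≼-antisym A≼c (maximal c A≼c (proj₁ (proj₂ (member⇒code c∈)))) = c∈

    codes-h : ∀ A → codes h A ≡ 𝒞 A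
    codes-h A = does-≡ (isCode? h A) (mk⇔ code⇒member member⇒code)

proposition6p1 : (m : ℕ) → Bijection (SDR (suc m)) (VGC m)
proposition6p1 m = record
  { to        = toVGC
  ; cong      = λ {f} {g} → toVGC-cong {f} {g}
  ; bijective = (λ {f} {g} → injective {f} {g}) , surjective
  }
  where
  open Codes m

  toVGC : Setoid.Carrier (SDR (suc m)) → Setoid.Carrier (VGC m)
  toVGC (f , sd , reg) =
    codes (onSubsets f) , codes-isVGC (regular⇒monotone reg) (selfDual⇒selfDualₛ sd)

  toVGC-cong : ∀ {f g} → Setoid._≈_ (SDR (suc m)) f g → Setoid._≈_ (VGC m) (toVGC f) (toVGC g)
  toVGC-cong {f , _} {g , _} f≈g = codes-cong (f≈g ∘ reverse)

  injective : ∀ {f g} → Setoid._≈_ (VGC m) (toVGC f) (toVGC g) → Setoid._≈_ (SDR (suc m)) f g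
  injective {f , sd , reg} {g , sd′ , reg′} same x =
    subst (λ y → f y ≡ g y) (reverse-involutive x)
      (codes-injective (regular⇒monotone reg) (selfDual⇒selfDualₛ sd)
                       (regular⇒monotone reg′) (selfDual⇒selfDualₛ sd′) same (reverse x))

  surjective : ∀ 𝒞 → Σ _ λ f → ∀ {g} → Setoid._≈_ (SDR (suc m)) g f → Setoid._≈_ (VGC m) (toVGC g) 𝒞
  surjective (𝒞 , vgc) = (onSubsets h , selfDualₛ⇒selfDual h-selfDual , monotone⇒regular h-monotone) ,
    λ g≈f A → trans (codes-cong (g≈f ∘ reverse) A)
                    (trans (codes-cong (cong h ∘ reverse-involutive) A) (codes-h A))
    where open FromVGC 𝒞 vgc
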